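{- Let $(A,X,I)$ be a formal context and $R_s,R_t,R_w\subseteq A\times X$ be $I$-compatible. Then $R_{s(tw)}=R_{(st)w}$, i.e. the $I$-product of $R_s$ with the $I$-product of $R_t$ and $R_w$ equals the $I$-product of the $I$-product of $R_s$ and $R_t$ with $R_w$.
   Context: For $S\subseteq A\times X$, $B\subseteq A$, $Y\subseteq X$: $S^\uparrow[B]=\{x\mid\forall a\in B,\ aSx\}$, $S^\downarrow[Y]=\{a\mid\forall x\in Y,\ aSx\}$, $S^\uparrow[a]=S^\uparrow[\{a\}]$, $S^\downarrow[x]=S^\downarrow[\{x\}]$, $B^\uparrow=I^\uparrow[B]$, $Y^\downarrow=I^\downarrow[Y]$, $x^{\downarrow\uparrow}=\{x\}^{\downarrow\uparrow}$. Galois-stable: $B=B^{\uparrow\downarrow}$, $Y=Y^{\downarrow\uparrow}$. $R$ is $I$-compatible if $R^\downarrow[x]$ and $R^\uparrow[a]$ are Galois-stable for all $x,a$. The $I$-product of $R_u,R_v$ is $R_{uv}\subseteq A\times X$ with $aR_{uv}x$ iff $a\in R_u^\downarrow[I^\uparrow[R_v^\downarrow[x^{\downarrow\uparrow}]]]$. -}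

module Defs where

open import Level using (Level; _⊔_)
open import Data.Product using (_×_)
open import Relation.Binary.PropositionalEquality using (_≡_)

Pred : ∀ {a} → Set a → (ℓ : Level) → Set (a ⊔ Level.suc ℓ)
Pred A ℓ = A → Set ℓ

_⊆_ : ∀ {a ℓ} {A : Set a} → Pred A ℓ → Pred A ℓ → Set (a ⊔ ℓ)
P ⊆ Q = ∀ x → P x → Q x

_≐_ : ∀ {a ℓ} {A : Set a} → Pred A ℓ → Pred A ℓ → Set (a ⊔ ℓ)
P ≐ Q = (P ⊆ Q) × (Q ⊆ P)

Rel : Set → Set → Set₁
Rel A X = A → X → Set

record Context : Set₁ where
  field
    A : Set
    X : Set
    I : Rel A X

module _ {A X : Set} where
  up : Rel A X → Pred A Level.zero → Pred X Level.zero
  up S B x = ∀ a → B a → S a x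

  down : Rel A X → Pred X Level.zero → Pred A Level.zero
  down S Y a = ∀ x → Y x → S a x

  up₁ : Rel A X → A → Pred X Level.zero
  up₁ S a = up S (λ a' → a' ≡ a)

  down₁ : Rel A X → X → Pred A Level.zero
  down₁ S x = down S (λ x' → x' ≡ x)

module _ (C : Context) where
  open Context C

  StableA : Pred A Level.zero → Set
  StableA B = down I (up I B) ≐ B

  StableX : Pred X Level.zero → Set
  StableX Y = up I (down I Y) ≐ Y

  Compatible : Rel A X → Set
  Compatible R = (∀ x → StableA (down₁ R x)) × (∀ a → StableX (up₁ R a))

  closX : X → Pred X Level.zero
  closX x = up I (down I (λ x' → x' ≡ x))

  prod : Rel A X → Rel A X → Rel A X
  prod Ru Rv a x = down Ru (up I (down Rv (closX x))) a

  _≐R_ : Rel A X → Rel A X → Set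
  R ≐R S = ∀ a x → (R a x → S a x) × (S a x → R a x)

module Submission where

-- Write B↑ = I↑[B], Y↓ = I↓[Y].  The proof rests on three observations.
-- (1) A relation R is *saturated* when every R↑[b] is closed under
--     x ↦ x↓↑.  Compatible relations and all I-products are saturated, and
--     for saturated Rv the product simplifies to its pointwise form
--     a R_uv x  ⟺  a ∈ Ru↓[(Rv↓[x])↑].
-- (2) If every Ru↑[a] is Galois-stable, then Ru↓[Y] = Ru↓[Y↓↑].
-- (3) For Galois-stable sets B_z, (⋂ B_z)↑ ⊆ (⋃ B_z↑)↓↑.
-- Put Z = (Rw↓[x])↑.  By (1) both bracketings, at a fixed x, unfold to
--     a R_{s(tw)} x  ⟺  a ∈ Rs↓[(Rt↓[Z])↑],
--     a R_{(st)w} x  ⟺  a ∈ Rs↓[⋃_{z ∈ Z} (Rt↓[z])↑],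
-- and these two sets agree by (2) and (3), using that the Rt↓[z] are stable.

open import Defs
open import Data.Product using (∃; _×_; _,_; proj₁; proj₂)
open import Level using (0ℓ)
open import Relation.Binary.PropositionalEquality using (_≡_; refl)

module Development (C : Context) where
  open Context C

  ≐-sym : ∀ {T : Set} {P Q : Pred T 0ℓ} → P ≐ Q → Q ≐ P
  ≐-sym (P⊆Q , Q⊆P) = Q⊆P , P⊆Q

  ≐-trans : ∀ {T : Set} {P Q S : Pred T 0ℓ} → P ≐ Q → Q ≐ S → P ≐ S
  ≐-trans (P⊆Q , Q⊆P) (Q⊆S , S⊆Q) =
    (λ t p → Q⊆S t (P⊆Q t p)) , (λ t s → Q⊆P t (S⊆Q t s))

  up-antitone : ∀ (S : Rel A X) {B B' : Pred A 0ℓ} → B ⊆ B' → up S B' ⊆ up S B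
  up-antitone S B⊆B' x x∈B'↑ a a∈B = x∈B'↑ a (B⊆B' a a∈B)

  down-antitone : ∀ (S : Rel A X) {Y Y' : Pred X 0ℓ} → Y ⊆ Y' → down S Y' ⊆ down S Y
  down-antitone S Y⊆Y' a a∈Y'↓ x x∈Y = a∈Y'↓ x (Y⊆Y' x x∈Y)

  up-cong : ∀ (S : Rel A X) {B B' : Pred A 0ℓ} → B ≐ B' → up S B ≐ up S B'
  up-cong S (B⊆B' , B'⊆B) = up-antitone S B'⊆B , up-antitone S B⊆B'

  down-cong : ∀ (S : Rel A X) {Y Y' : Pred X 0ℓ} → Y ≐ Y' → down S Y ≐ down S Y'
  down-cong S (Y⊆Y' , Y'⊆Y) = down-antitone S Y'⊆Y , down-antitone S Y⊆Y'

  closure-extensive : ∀ (Y : Pred X 0ℓ) → Y ⊆ up I (down I Y)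
  closure-extensive Y x x∈Y a a∈Y↓ = a∈Y↓ x x∈Y

  -- (2): when every R↑[a] is stable, R↓[Y] already contains R↓[Y↓↑],
  -- because Y ⊆ R↑[a] forces Y↓↑ ⊆ R↑[a]↓↑ = R↑[a].
  down-closure : ∀ (R : Rel A X) → (∀ a → StableX C (up₁ R a))
    → ∀ Y → down R Y ⊆ down R (up I (down I Y))
  down-closure R stable Y a a∈R↓Y x x∈Y↓↑ =
    proj₁ (stable a) x (up-antitone I (down-antitone I Y⊆R↑a) x x∈Y↓↑) a refl
    where
    Y⊆R↑a : Y ⊆ up₁ R a
    Y⊆R↑a y y∈Y _ refl = a∈R↓Y y y∈Y

  -- (3): the extent of an intersection of stable sets lies in the closure
  -- of the union of their extents, since (⋃ B_z↑)↓ = ⋂ B_z↑↓ = ⋂ B_z.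
  up-⋂ : ∀ {J : Set} (Z : Pred J 0ℓ) (B : J → Pred A 0ℓ) → (∀ z → StableA C (B z))
    → up I (λ b → ∀ z → Z z → B z b)
      ⊆ up I (down I (λ x → ∃ λ z → Z z × up I (B z) x))
  up-⋂ Z B stable = up-antitone I ⋃↓⊆⋂
    where
    ⋃↓⊆⋂ : down I (λ x → ∃ λ z → Z z × up I (B z) x) ⊆ (λ b → ∀ z → Z z → B z b)
    ⋃↓⊆⋂ b b∈⋃↓ z z∈Z = proj₁ (stable z) b (λ x x∈Bz↑ → b∈⋃↓ x (z , z∈Z , x∈Bz↑))

  closX-trans : ∀ {x z w : X} → closX C x z → closX C z w → closX C x w
  closX-trans z∈x↓↑ w∈z↓↑ a a∈x↓ = w∈z↓↑ a (λ { _ refl → z∈x↓↑ a a∈x↓ })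

  Saturated : Rel A X → Set
  Saturated R = ∀ b x z → closX C x z → R b x → R b z

  -- Compatibility implies saturation: the singleton case of (2).
  compatible-saturated : ∀ R → Compatible C R → Saturated R
  compatible-saturated R (_ , stable) b x z z∈x↓↑ bRx =
    down-closure R stable (λ x' → x' ≡ x) b (λ { _ refl → bRx }) z z∈x↓↑

  -- Every I-product is saturated, as it depends on x only through x↓↑.
  prod-saturated : ∀ Ru Rv → Saturated (prod C Ru Rv)
  prod-saturated Ru Rv b x z z∈x↓↑ =
    down-antitone Ru (up-antitone I (down-antitone Rv (λ w → closX-trans z∈x↓↑))) b

  saturated-down : ∀ R → Saturated R → ∀ x → down R (closX C x) ≐ down₁ R x
  saturated-down R sat x =
    down-antitone R (closure-extensive (λ x' → x' ≡ x)) ,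
    λ b b∈R↓x z z∈x↓↑ → sat b x z z∈x↓↑ (b∈R↓x x refl)

  prod-column : ∀ Ru Rv → Saturated Rv → ∀ x
    → down₁ (prod C Ru Rv) x ≐ down Ru (up I (down₁ Rv x))
  prod-column Ru Rv sat x =
    ≐-trans column-at-x (down-cong Ru (up-cong I (saturated-down Rv sat x)))
    where
    column-at-x : down₁ (prod C Ru Rv) x ≐ down Ru (up I (down Rv (closX C x)))
    column-at-x = (λ a h → h x refl) , λ { a h _ refl → h }

  extent-union : Rel A X → Pred X 0ℓ → Pred X 0ℓ
  extent-union Rt Z y = ∃ λ z → Z z × up I (down₁ Rt z) y

  -- Rs↓[(Rt↓[Z])↑] = Rs↓[⋃_{z ∈ Z} (Rt↓[z])↑]: "⊆" because the union lies
  -- in (Rt↓[Z])↑, "⊇" by (2) and (3) applied to the stable sets Rt↓[z].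
  down-extent-union : ∀ Rs Rt → (∀ a → StableX C (up₁ Rs a)) → (∀ z → StableA C (down₁ Rt z))
    → ∀ Z → down Rs (up I (down Rt Z)) ≐ down Rs (extent-union Rt Z)
  down-extent-union Rs Rt Rs-stable Rt-stable Z =
    down-antitone Rs union⊆extent ,
    λ a a∈Rs↓ → down-antitone Rs extent⊆closure a
                  (down-closure Rs Rs-stable (extent-union Rt Z) a a∈Rs↓)
    where
    union⊆extent : extent-union Rt Z ⊆ up I (down Rt Z)
    union⊆extent y (z , z∈Z , y∈extent) b b∈Rt↓Z = y∈extent b (λ { _ refl → b∈Rt↓Z z z∈Z })

    ⋂⊆Rt↓Z : (λ b → ∀ z → Z z → down₁ Rt z b) ⊆ down Rt Z
    ⋂⊆Rt↓Z b b∈⋂ z z∈Z = b∈⋂ z z∈Z z refl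

    extent⊆closure : up I (down Rt Z) ⊆ up I (down I (extent-union Rt Z))
    extent⊆closure y y∈extent =
      up-⋂ Z (down₁ Rt) Rt-stable y (up-antitone I ⋂⊆Rt↓Z y y∈extent)

  -- For saturated Rv, (R_uv)↓[Z] = Ru↓[⋃_{z ∈ Z} (Rv↓[z])↑], by (1) at each z ∈ Z.
  down-prod : ∀ Ru Rv → Saturated Rv → ∀ Z
    → down (prod C Ru Rv) Z ≐ down Ru (extent-union Rv Z)
  down-prod Ru Rv sat Z =
    (λ a a∈R↓Z y (z , z∈Z , y∈extent) →
       proj₁ (prod-column Ru Rv sat z) a (λ { _ refl → a∈R↓Z z z∈Z }) y y∈extent) ,
    (λ a a∈Ru↓ z z∈Z →
       proj₂ (prod-column Ru Rv sat z) a (λ y y∈extent → a∈Ru↓ y (z , z∈Z , y∈extent)) z refl)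

  columns-equal : ∀ (R S : Rel A X) → (∀ x → down₁ R x ≐ down₁ S x) → _≐R_ C R S
  columns-equal R S eq a x =
    (λ aRx → proj₁ (eq x) a (λ { _ refl → aRx }) x refl) ,
    (λ aSx → proj₂ (eq x) a (λ { _ refl → aSx }) x refl)

lemmaA10 : (C : Context) → (Rs Rt Rw : Rel (Context.A C) (Context.X C))
    → Compatible C Rs → Compatible C Rt → Compatible C Rw
    → _≐R_ C (prod C Rs (prod C Rt Rw)) (prod C (prod C Rs Rt) Rw)
lemmaA10 C Rs Rt Rw cs ct cw = columns-equal _ _ λ x →
  ≐-trans (left-column x) (≐-sym (right-column x))
  where
  open Context C
  open Development C
  Rt-sat : Saturated Rt
  Rt-sat = compatible-saturated Rt ct

  Rw-sat : Saturated Rw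
  Rw-sat = compatible-saturated Rw cw

  left-column : ∀ x → down₁ (prod C Rs (prod C Rt Rw)) x
                      ≐ down Rs (extent-union Rt (up I (down₁ Rw x)))
  left-column x =
    ≐-trans (prod-column Rs (prod C Rt Rw) (prod-saturated Rt Rw) x)
   (≐-trans (down-cong Rs (up-cong I (prod-column Rt Rw Rw-sat x)))
            (down-extent-union Rs Rt (proj₂ cs) (proj₁ ct) (up I (down₁ Rw x))))

  right-column : ∀ x → down₁ (prod C (prod C Rs Rt) Rw) x
                       ≐ down Rs (extent-union Rt (up I (down₁ Rw x)))
  right-column x =
    ≐-trans (prod-column (prod C Rs Rt) Rw Rw-sat x)
            (down-prod Rs Rt Rt-sat (up I (down₁ Rw x)))
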